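{- Let $\mathbf{L}=\langle L,\leq\rangle$ be a complete lattice and $S$ an $L$-parameterization. A system $\mathcal{S}\subseteq L$ is an $S$-closure system in $\mathbf{L}$ if and only if for every $a\in L$, $$\bigwedge\{h(b);\ a\leq h(b),\ b\in\mathcal{S},\ \langle f,h\rangle\in S\}\in\mathcal{S}.$$
   Context: An isotone Galois connection in $\mathbf{L}$ is a pair $\langle f,h\rangle$ of maps $L\to L$ with $f(a)\leq b$ iff $a\leq h(b)$. An $L$-parameterization is a set $S$ of isotone Galois connections containing $\langle\mathrm{id},\mathrm{id}\rangle$. A closure system in $\mathbf{L}$ is a subset of $L$ closed under arbitrary infima (including the empty infimum $1$). An $S$-closure system is a closure system $\mathcal{S}$ in $\mathbf{L}$ such that $h(a)\in\mathcal{S}$ for all $\langle f,h\rangle\in S$ and all $a\in\mathcal{S}$. -}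

module Defs where

open import Level using (Level; suc; _⊔_)
open import Function using (id)
open import Function.Bundles using (_⇔_)
open import Data.Product using (Σ; _×_; _,_)
open import Relation.Unary using (Pred; _∈_; _⊆_)
open import Relation.Binary.Core using (Rel)
open import Relation.Binary.Structures using (IsPartialOrder)
open import Relation.Binary.PropositionalEquality using (_≡_)

record CompleteLattice (ℓ : Level) : Set (suc ℓ) where
  field
    Carrier        : Set ℓ
    _≤_            : Rel Carrier ℓ
    isPartialOrder : IsPartialOrder _≡_ _≤_
    ⋀              : Pred Carrier ℓ → Carrier
    ⋀-lower        : ∀ (X : Pred Carrier ℓ) {x} → x ∈ X → ⋀ X ≤ x
    ⋀-greatest     : ∀ (X : Pred Carrier ℓ) {y} → (∀ {x} → x ∈ X → y ≤ x) → y ≤ ⋀ X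

module _ {ℓ : Level} (𝐋 : CompleteLattice ℓ) where
  open CompleteLattice 𝐋

  Endo : Set ℓ
  Endo = Carrier → Carrier

  IsGaloisConnection : Endo → Endo → Set ℓ
  IsGaloisConnection f h = ∀ a b → (f a ≤ b) ⇔ (a ≤ h b)

  IsParameterization : Pred (Endo × Endo) ℓ → Set ℓ
  IsParameterization S =
    (∀ {f h} → (f , h) ∈ S → IsGaloisConnection f h) × ((id , id) ∈ S)

  IsClosureSystem : Pred Carrier ℓ → Set (suc ℓ)
  IsClosureSystem 𝒮 = ∀ (X : Pred Carrier ℓ) → X ⊆ 𝒮 → ⋀ X ∈ 𝒮

  IsSClosureSystem : Pred (Endo × Endo) ℓ → Pred Carrier ℓ → Set (suc ℓ)
  IsSClosureSystem S 𝒮 =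
    IsClosureSystem 𝒮 × (∀ {f h} → (f , h) ∈ S → ∀ {a} → a ∈ 𝒮 → h a ∈ 𝒮)

  HSet : Pred (Endo × Endo) ℓ → Pred Carrier ℓ → Carrier → Pred Carrier ℓ
  HSet S 𝒮 a x =
    Σ Endo λ f → Σ Endo λ h → Σ Carrier λ b →
      ((f , h) ∈ S) × (b ∈ 𝒮) × (a ≤ h b) × (x ≡ h b)

-- A fixed point of a ↦ ⋀ {h b ; a ≤ h b, b ∈ 𝒮, ⟨f,h⟩ ∈ S} lies in 𝒮 whenever all
-- these infima do, and since a is always below that infimum, being a fixed point
-- only needs the reverse inequality. For a = h b with b ∈ 𝒮 it holds because h b
-- is itself in the indexing set; for a = ⋀ X with X ⊆ 𝒮 it holds because ⟨id,id⟩
-- puts every element of X into the indexing set.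
module Submission where

open import Defs
open import Level using (Level)
open import Function using (id)
open import Function.Bundles using (_⇔_; mk⇔)
open import Data.Product using (_×_; _,_)
open import Relation.Unary using (Pred; _∈_; _⊆_)
open import Relation.Binary.PropositionalEquality using (refl; subst)
open import Relation.Binary.Structures using (IsPartialOrder)

module _ {ℓ : Level} (𝐋 : CompleteLattice ℓ) where
  open CompleteLattice 𝐋
  open IsPartialOrder isPartialOrder using (antisym)

  ⋀-antitone : ∀ {X Y : Pred Carrier ℓ} → X ⊆ Y → ⋀ Y ≤ ⋀ X
  ⋀-antitone {X} {Y} X⊆Y = ⋀-greatest X λ x∈X → ⋀-lower Y (X⊆Y x∈X)

  module _ (S : Pred (Endo 𝐋 × Endo 𝐋) ℓ) (𝒮 : Pred Carrier ℓ) where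

    ≤-⋀-HSet : ∀ a → a ≤ ⋀ (HSet 𝐋 S 𝒮 a)
    ≤-⋀-HSet a = ⋀-greatest _ λ { (_ , _ , _ , _ , _ , a≤hb , refl) → a≤hb }

    HSet⊆ : (∀ {f h} → (f , h) ∈ S → ∀ {b} → b ∈ 𝒮 → h b ∈ 𝒮) →
            ∀ a → HSet 𝐋 S 𝒮 a ⊆ 𝒮
    HSet⊆ h-closed a (_ , _ , _ , fh∈S , b∈𝒮 , _ , refl) = h-closed fh∈S b∈𝒮

    ⊆-HSet-⋀ : (id , id) ∈ S → ∀ {X} → X ⊆ 𝒮 → X ⊆ HSet 𝐋 S 𝒮 (⋀ X)
    ⊆-HSet-⋀ id∈S {X} X⊆𝒮 {x} x∈X = id , id , x , id∈S , X⊆𝒮 x∈X , ⋀-lower X x∈X , refl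

    ∈-if-⋀-HSet-≤ : (∀ a → ⋀ (HSet 𝐋 S 𝒮 a) ∈ 𝒮) →
                    ∀ {a} → ⋀ (HSet 𝐋 S 𝒮 a) ≤ a → a ∈ 𝒮
    ∈-if-⋀-HSet-≤ ⋀-HSet∈𝒮 {a} ⋀≤a =
      subst (_∈ 𝒮) (antisym ⋀≤a (≤-⋀-HSet a)) (⋀-HSet∈𝒮 a)

theorem41 : ∀ {ℓ : Level} (𝐋 : CompleteLattice ℓ) (S : Pred (Endo 𝐋 × Endo 𝐋) ℓ) →
    IsParameterization 𝐋 S → (𝒮 : Pred (CompleteLattice.Carrier 𝐋) ℓ) →
    IsSClosureSystem 𝐋 S 𝒮 ⇔ (∀ a → CompleteLattice.⋀ 𝐋 (HSet 𝐋 S 𝒮 a) ∈ 𝒮)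
theorem41 𝐋 S (_ , id∈S) 𝒮 = mk⇔ infima-in-𝒮 sclosure
  where
  open CompleteLattice 𝐋
  open IsPartialOrder isPartialOrder using () renaming (refl to ≤-refl)

  infima-in-𝒮 : IsSClosureSystem 𝐋 S 𝒮 → ∀ a → ⋀ (HSet 𝐋 S 𝒮 a) ∈ 𝒮
  infima-in-𝒮 (closed , h-closed) a = closed _ (HSet⊆ 𝐋 S 𝒮 h-closed a)

  sclosure : (∀ a → ⋀ (HSet 𝐋 S 𝒮 a) ∈ 𝒮) → IsSClosureSystem 𝐋 S 𝒮
  sclosure ⋀-HSet∈𝒮 = closed , h-closed
    where
    closed : IsClosureSystem 𝐋 𝒮
    closed X X⊆𝒮 = ∈-if-⋀-HSet-≤ 𝐋 S 𝒮 ⋀-HSet∈𝒮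
      (⋀-antitone 𝐋 (⊆-HSet-⋀ 𝐋 S 𝒮 id∈S X⊆𝒮))

    h-closed : ∀ {f h} → (f , h) ∈ S → ∀ {b} → b ∈ 𝒮 → h b ∈ 𝒮
    h-closed {f} {h} fh∈S {b} b∈𝒮 = ∈-if-⋀-HSet-≤ 𝐋 S 𝒮 ⋀-HSet∈𝒮
      (⋀-lower _ (f , h , b , fh∈S , b∈𝒮 , ≤-refl , refl))
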